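{- Let $t,q\in \mathcal{Q}_d^+$, let $g$ be the content of $q$, and let $q_0=\frac{1}{g}q$. Then \[ m(t,q) = r_{ -2[q_0]}^+(t). \]
   Context: Let $L'=\{(\begin{smallmatrix} -x & y \\ z & x\end{smallmatrix}) : x,y,z\in\mathbb{Z}\}$ with quadratic form $Q(X)=-\det X$ and bilinear form $(X,Y)=\tr(XY)$, and for $X=(X_1,X_2)\in (L')^2$ let $Q(X)=\frac12((X_i,X_j))_{i,j}$. For $X_i=(\begin{smallmatrix} -x_i & y_i \\ z_i & x_i\end{smallmatrix})$, the binary quadratic form associated with $X=(X_1,X_2)$ is $ax^2+bxy+cy^2$ with $a=x_1z_2-z_1x_2$, $b=z_1y_2-y_1z_2$, $c=x_1y_2-y_1x_2$. Let $d<0$ be a discriminant, $\mathcal{Q}_d$ the integral binary quadratic forms of discriminant $d$, $\mathcal{Q}_d^+$ the positive definite ones, $\mathcal{C}_d=\mathcal{Q}_d^+/\mathrm{PSL}_2(\mathbb{Z})$, and $\mathcal{C}_d^0$ the form class group (classes of primitive forms), written additively; $[q]$ denotes the class of $q$. For a half-integral symmetric $T=(\begin{smallmatrix} t_1 & t_0\\ t_0 & t_2\end{smallmatrix})$ positive definite with $d=-4\det T$, let $t(x,y)=t_1x^2+2t_0xy+t_2y^2$, and let $m(t,q)=m(T,q)$ be the number of $X\in (L')^2$ with $Q(X)=T$ whose associated form equals $q$. For positive definite forms $t,q$ let $r_q^+(t)=\#\{h\in M_2(\mathbb{Z}) : t=q\cdot h,\ \det h>0\}$, where $(q\cdot(\begin{smallmatrix}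 a&b\\c&d\end{smallmatrix}))(x,y)=q(ax+by,cx+dy)$; this depends only on the classes of $t$ and $q$, so $r^+_{\mathfrak{C}}(t)$ makes sense for a class $\mathfrak{C}$. -}

module Defs where

open import Data.Nat using (ℕ)
open import Data.Integer using (ℤ; +_; _+_; _-_; _*_; -_; _<_; 0ℤ; 1ℤ)
open import Data.Integer.GCD using (gcd)
open import Data.Integer.Divisibility using (_∣_)
open import Data.Fin using (Fin)
open import Data.Product using (Σ; ∃; _×_; _,_)
open import Function.Bundles using (_↔_)
open import Relation.Binary.PropositionalEquality using (_≡_)

-- Integral binary quadratic forms  a x² + b x y + c y²

record Form : Set where
  constructor form
  field
    a b c : ℤ
open Form public

disc : Form → ℤ
disc (form a b c) = b * b - (+ 4) * a * c

PosDef : Form → Set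
PosDef q = (0ℤ < a q) × (disc q < 0ℤ)

content : Form → ℤ
content (form a b c) = gcd (gcd a b) c

scale : ℤ → Form → Form
scale g (form a b c) = form (g * a) (g * b) (g * c)

-- 2x2 integer matrices ( α β ; γ δ ) and the right action q · h,
-- (q · h)(x,y) = q(α x + β y, γ x + δ y)

record Mat : Set where
  constructor mat
  field
    α β γ δ : ℤ
open Mat public

det : Mat → ℤ
det (mat α β γ δ) = α * δ - β * γ

_·_ : Form → Mat → Form
form A B C · mat α β γ δ =
  form (A * α * α + B * α * γ + C * γ * γ)
       ((+ 2) * A * α * β + B * (α * δ + β * γ) + (+ 2) * C * γ * δ)
       (A * β * β + B * β * δ + C * δ * δ)

_∼_ : Form → Form → Set
f ∼ g = Σ Mat (λ h → (det h ≡ 1ℤ) × (g ≡ f · h))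

-- Form class group (written additively) via Dirichlet composition.
-- The inverse of the class of (a,b,c) is the class of (a,-b,c).

opposite : Form → Form
opposite (form a b c) = form a (- b) c

-- Dirichlet composition: for forms f₁ = (a₁,b₁,c₁), f₂ = (a₂,b₂,c₂)
-- of the same discriminant D with gcd(a₁,a₂,(b₁+b₂)/2) = 1, the form
-- f₃ = (a₁a₂, B, C) of discriminant D with B ≡ b₁ (mod 2a₁),
-- B ≡ b₂ (mod 2a₂) represents [f₁] + [f₂].
DirichletComp : Form → Form → Form → Set
DirichletComp (form a₁ b₁ c₁) (form a₂ b₂ c₂) (form a₃ b₃ c₃) =
  (disc (form a₂ b₂ c₂) ≡ disc (form a₁ b₁ c₁)) ×
  (disc (form a₃ b₃ c₃) ≡ disc (form a₁ b₁ c₁)) ×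
  (a₃ ≡ a₁ * a₂) ×
  (∃ λ e → (b₁ + b₂ ≡ (+ 2) * e) × (gcd (gcd a₁ a₂) e ≡ 1ℤ)) ×
  ((+ 2) * a₁ ∣ (b₃ - b₁)) ×
  ((+ 2) * a₂ ∣ (b₃ - b₂))

-- p lies in the class  -2[q₀]  (= [q₀⁻¹] + [q₀⁻¹])
InClassMinusTwice : Form → Form → Set
InClassMinusTwice q₀ p =
  Σ Form λ f₁ → Σ Form λ f₂ → Σ Form λ f₃ →
    (opposite q₀ ∼ f₁) × (opposite q₀ ∼ f₂) × DirichletComp f₁ f₂ f₃ × (f₃ ∼ p)

-- L' = { (-x y ; z x) } ≅ ℤ³ via (x,y,z);  Q(X) = x² + y z,
-- (X,Y) = tr(XY) = 2 x x' + y z' + z y'.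

record L' : Set where
  constructor elt
  field
    x y z : ℤ
open L' public

-- For X = (X₁,X₂) and T = (t₁ t₀ ; t₀ t₂) corresponding to the form
-- t = t₁ x² + 2t₀ x y + t₂ y²,  Q(X) = T  reads:
QEq : L' → L' → Form → Set
QEq (elt x₁ y₁ z₁) (elt x₂ y₂ z₂) (form t₁ tb t₂) =
  (x₁ * x₁ + y₁ * z₁ ≡ t₁) ×
  ((+ 2) * x₁ * x₂ + y₁ * z₂ + z₁ * y₂ ≡ tb) ×
  (x₂ * x₂ + y₂ * z₂ ≡ t₂)

assocForm : L' → L' → Form
assocForm (elt x₁ y₁ z₁) (elt x₂ y₂ z₂) =
  form (x₁ * z₂ - z₁ * x₂) (z₁ * y₂ - y₁ * z₂) (x₁ * y₂ - y₁ * x₂)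

MSet : Form → Form → Set
MSet t q = Σ L' λ X₁ → Σ L' λ X₂ → QEq X₁ X₂ t × (assocForm X₁ X₂ ≡ q)

RSet : Form → Form → Set
RSet p t = Σ Mat λ h → (t ≡ p · h) × (0ℤ < det h)

HasCard : Set → ℕ → Set
HasCard S n = Fin n ↔ S

{-# OPTIONS --safe #-}
module Submission where

-- Write q = g q₀ with q₀ primitive. If X = (X₁, X₂) has associated form g q₀, both Xᵢ lie in the
-- rank-two lattice of vectors killed by pairing q₀, and any e₁, e₂ with assocForm e₁ e₂ = q₀ form a
-- basis of it (Cramer's rule). For f₁, f₂ properly equivalent to q₀⁻¹ with Dirichlet composition f₃,
-- the bilinear map μ yields such a basis with Gram form f₃. Writing X = (e₁, e₂) h turns Q(X) = T into
-- t = f₃ · h and the associated form into det h · q₀, so m(t, q) counts the h with t = f₃ · h and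
-- det h = g. Comparing discriminants, det h² = g² for every such h, so det h = g is the same as
-- det h > 0: m(t, q) = r⁺_{f₃}(t) = r⁺_p(t), and these sets are finite because f₃ is definite.

open import Defs
open import Data.Nat using (ℕ)
open import Data.Integer using (ℤ; _<_; 0ℤ)
open import Data.Product using (∃; _×_)
open import Relation.Binary.PropositionalEquality using (_≡_)

open import Axiom.UniquenessOfIdentityProofs using (module Decidable⇒UIP)
open import Data.Fin as Fin using (Fin; toℕ; fromℕ<)
import Data.Fin.Properties as Finₚ
import Data.Nat as ℕ
open import Data.Nat.GCD using (gcd-GCD; module Bézout)
import Data.Nat.GCD as ℕ
import Data.Nat.Properties as ℕₚ
open import Data.Integer as ℤ using (+_; +[1+_]; -[1+_]; _+_; _-_; _*_; -_; _≤_; 1ℤ; ∣_∣; +≤+; -≤+)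
import Data.Integer.Divisibility.Signed as Signed
open import Data.Integer.GCD using (gcd; gcd[i,j]≡0⇒i≡0)
import Data.Integer.Properties as ℤₚ
open import Data.Integer.Tactic.RingSolver using (solve-∀)
open import Data.Product using (Σ; ∃₂; _,_; proj₁; proj₂)
open import Data.Product.Function.Dependent.Propositional using (Σ-↔)
open import Data.Product.Function.NonDependent.Propositional using (_×-↔_)
open import Data.Sum using (_⊎_; inj₁; inj₂)
open import Data.Sum.Function.Propositional using (_⊎-↔_)
open import Function using (_∘_)
open import Function.Bundles using (_↔_; mk↔ₛ′; Inverse)
open import Function.Properties.Inverse using (↔-refl; ↔-sym; ↔-trans)
open import Relation.Binary.Definitions using (DecidableEquality)
open import Relation.Binary.PropositionalEquality
  using (refl; sym; trans; cong; cong₂; subst; _≢_; module ≡-Reasoning)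
open import Relation.Nullary using (Dec; yes; no; contradiction)
open import Relation.Nullary.Decidable using (_×-dec_; map′)
open import Relation.Nullary.Irrelevant using (Irrelevant)
open import Relation.Unary using (Decidable)

cong₃ : ∀ {A B C D : Set} (f : A → B → C → D) {x x′ y y′ z z′} →
        x ≡ x′ → y ≡ y′ → z ≡ z′ → f x y z ≡ f x′ y′ z′
cong₃ f refl refl refl = refl

cong₄ : ∀ {A B C D E : Set} (f : A → B → C → D → E) {x x′ y y′ z z′ w w′} →
        x ≡ x′ → y ≡ y′ → z ≡ z′ → w ≡ w′ → f x y z w ≡ f x′ y′ z′ w′
cong₄ f refl refl refl refl = refl

-- Integers

square-nonNeg : ∀ i → 0ℤ ≤ i * i
square-nonNeg (+ 0)    = +≤+ ℕ.z≤n
square-nonNeg +[1+ n ] = +≤+ ℕ.z≤n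
square-nonNeg -[1+ n ] = +≤+ ℕ.z≤n

∣i∣≤i*i : ∀ i → + ∣ i ∣ ≤ i * i
∣i∣≤i*i (+ 0)    = +≤+ ℕ.z≤n
∣i∣≤i*i +[1+ n ] = +≤+ (ℕₚ.m≤m*n (ℕ.suc n) (ℕ.suc n))
∣i∣≤i*i -[1+ n ] = +≤+ (ℕₚ.m≤m*n (ℕ.suc n) (ℕ.suc n))

nonNeg-* : ∀ {i j} → 0ℤ ≤ i → 0ℤ ≤ j → 0ℤ ≤ i * j
nonNeg-* {i} {j} 0≤i 0≤j = ℤₚ.*-monoʳ-≤-nonNeg j {{ℤ.nonNegative 0≤j}} 0≤i

i≤+∣i∣ : ∀ i → i ≤ + ∣ i ∣
i≤+∣i∣ (+ n)    = ℤₚ.≤-refl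
i≤+∣i∣ -[1+ n ] = -≤+

square-injective-pos : ∀ {i j} → 0ℤ < i → 0ℤ < j → i * i ≡ j * j → i ≡ j
square-injective-pos {i} {j} 0<i 0<j i²≡j² with ℤₚ.i*j≡0⇒i≡0∨j≡0 (i - j) difference-of-squares
  where
  open ≡-Reasoning
  factor : ∀ i j → (i - j) * (i + j) ≡ i * i - j * j
  factor = solve-∀
  difference-of-squares : (i - j) * (i + j) ≡ 0ℤ
  difference-of-squares = begin
    (i - j) * (i + j) ≡⟨ factor i j ⟩
    i * i - j * j     ≡⟨ cong (_- j * j) i²≡j² ⟩
    j * j - j * j     ≡⟨ ℤₚ.+-inverseʳ (j * j) ⟩
    0ℤ                ∎
... | inj₁ i-j≡0 = ℤₚ.i-j≡0⇒i≡j i j i-j≡0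
... | inj₂ i+j≡0 = contradiction i+j≡0 (ℤₚ.<⇒≢ (ℤₚ.+-mono-< 0<i 0<j) ∘ sym)

j≡i-k : ∀ i {j k} → i - j ≡ k → j ≡ i - k
j≡i-k i {j} refl = sym (i-[i-j] i j)
  where
  i-[i-j] : ∀ i j → i - (i - j) ≡ j
  i-[i-j] = solve-∀

≡-irrelevantℤ : ∀ {i j : ℤ} → Irrelevant (i ≡ j)
≡-irrelevantℤ = Decidable⇒UIP.≡-irrelevant ℤ._≟_

ℕ-identity⇒ℤ : ∀ {d m n x y} → d ℕ.+ y ℕ.* n ≡ x ℕ.* m → + d ≡ + x * + m + (- + y) * + n
ℕ-identity⇒ℤ {d} {m} {n} {x} {y} eq = begin
  + d                              ≡⟨ move (+ d) (+ y) (+ n) ⟩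
  + d + + y * + n + (- + y) * + n  ≡⟨ cong (λ k → k + (- + y) * + n) cast ⟩
  + x * + m + (- + y) * + n        ∎
  where
  open ≡-Reasoning
  move : ∀ D Y N → D ≡ D + Y * N + (- Y) * N
  move = solve-∀
  cast : + d + + y * + n ≡ + x * + m
  cast = begin
    + d + + y * + n    ≡⟨ cong (λ k → + d + k) (ℤₚ.pos-* y n) ⟨
    + d + + (y ℕ.* n)  ≡⟨ ℤₚ.pos-+ d (y ℕ.* n) ⟨
    + (d ℕ.+ y ℕ.* n)  ≡⟨ cong +_ eq ⟩
    + (x ℕ.* m)        ≡⟨ ℤₚ.pos-* x m ⟩
    + x * + m          ∎

ℕ-bézout : ∀ m n → ∃₂ λ x y → + ℕ.gcd m n ≡ x * + m + y * + n
ℕ-bézout m n with Bézout.identity (gcd-GCD m n)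
... | Bézout.Identity.+- x y eq = + x , - + y , ℕ-identity⇒ℤ {m = m} {n} {x} {y} eq
... | Bézout.Identity.-+ x y eq =
  - + x , + y , trans (ℕ-identity⇒ℤ {m = n} {m} {y} {x} eq) (ℤₚ.+-comm (+ y * + n) _)

+∣i∣-multiple : ∀ i → ∃ λ s → + ∣ i ∣ ≡ s * i
+∣i∣-multiple i with ℤₚ.+∣i∣≡i⊎+∣i∣≡-i i
... | inj₁ ∣i∣≡i  = 1ℤ , trans ∣i∣≡i (sym (ℤₚ.*-identityˡ i))
... | inj₂ ∣i∣≡-i = - 1ℤ , trans ∣i∣≡-i (sym (ℤₚ.-1*i≡-i i))

bézout : ∀ i j → ∃₂ λ u v → gcd i j ≡ u * i + v * j
bézout i j with ℕ-bézout ∣ i ∣ ∣ j ∣ | +∣i∣-multiple i | +∣i∣-multiple j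
... | x , y , eq | s , ∣i∣≡si | s′ , ∣j∣≡s′j = x * s , y * s′ , (begin
  gcd i j                     ≡⟨ eq ⟩
  x * + ∣ i ∣ + y * + ∣ j ∣   ≡⟨ cong₂ (λ I J → x * I + y * J) ∣i∣≡si ∣j∣≡s′j ⟩
  x * (s * i) + y * (s′ * j)  ≡⟨ reassociate x s i y s′ j ⟩
  x * s * i + y * s′ * j      ∎)
  where
  open ≡-Reasoning
  reassociate : ∀ x s i y s′ j → x * (s * i) + y * (s′ * j) ≡ x * s * i + y * s′ * j
  reassociate = solve-∀

bézout₃ : ∀ i j k → ∃ λ u → ∃₂ λ v w → gcd (gcd i j) k ≡ u * i + v * j + w * k
bézout₃ i j k =
  let u , v , gcd≡ = bézout i j
      u′ , w , gcd₃≡ = bézout (gcd i j) k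
  in u′ * u , u′ * v , w , (begin
    gcd (gcd i j) k                 ≡⟨ gcd₃≡ ⟩
    u′ * gcd i j + w * k            ≡⟨ cong (λ G → u′ * G + w * k) gcd≡ ⟩
    u′ * (u * i + v * j) + w * k    ≡⟨ distribute u′ u i v j w k ⟩
    u′ * u * i + u′ * v * j + w * k ∎)
  where
  open ≡-Reasoning
  distribute : ∀ u′ u i v j w k → u′ * (u * i + v * j) + w * k ≡ u′ * u * i + u′ * v * j + w * k
  distribute = solve-∀

-- Binary forms and 2×2 matrices

-- Chosen so that a (f · h), b (f · h) and det h are definitionally value f (col₁ h),
-- polar f (col₁ h) (col₂ h) and det₂ (col₁ h) (col₂ h).
value : Form → ℤ × ℤ → ℤ
value (form a b c) (x , y) = a * x * x + b * x * y + c * y * y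

polar : Form → ℤ × ℤ → ℤ × ℤ → ℤ
polar (form a b c) (x , y) (x′ , y′) = (+ 2) * a * x * x′ + b * (x * y′ + x′ * y) + (+ 2) * c * y * y′

det₂ : ℤ × ℤ → ℤ × ℤ → ℤ
det₂ (x , y) (x′ , y′) = x * y′ - x′ * y

col₁ col₂ : Mat → ℤ × ℤ
col₁ (mat α β γ δ) = α , γ
col₂ (mat α β γ δ) = β , δ

infixl 6 _⊞_
_⊞_ : Form → Form → Form
form a b c ⊞ form a′ b′ c′ = form (a + a′) (b + b′) (c + c′)

lin : ℤ → ℤ → ℤ → Form → ℤ
lin u v w (form a b c) = u * a + v * b + w * c

Primitive : Form → Set
Primitive q = ∃ λ u → ∃₂ λ v w → lin u v w q ≡ 1ℤ

infixl 7 _⊗_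
_⊗_ : Mat → Mat → Mat
mat α β γ δ ⊗ mat α′ β′ γ′ δ′ =
  mat (α * α′ + β * γ′) (α * β′ + β * δ′) (γ * α′ + δ * γ′) (γ * β′ + δ * δ′)

adj : Mat → Mat
adj (mat α β γ δ) = mat δ (- β) (- γ) α

infix 4 _≟ᶠ_
_≟ᶠ_ : DecidableEquality Form
form a b c ≟ᶠ form a′ b′ c′ =
  map′ (λ { (refl , refl , refl) → refl }) (λ { refl → refl , refl , refl })
       (a ℤ.≟ a′ ×-dec b ℤ.≟ b′ ×-dec c ℤ.≟ c′)

≡-irrelevantᶠ : ∀ {f g : Form} → Irrelevant (f ≡ g)
≡-irrelevantᶠ = Decidable⇒UIP.≡-irrelevant _≟ᶠ_

·-⊗ : ∀ f h k → (f · h) · k ≡ f · (h ⊗ k)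
·-⊗ (form A B C) (mat α β γ δ) (mat α′ β′ γ′ δ′) =
  cong₃ form (value-· A B C α β γ δ α′ γ′) (polar-· A B C α β γ δ α′ γ′ β′ δ′)
             (value-· A B C α β γ δ β′ δ′)
  where
  value-· : ∀ A B C α β γ δ x y →
    (A * α * α + B * α * γ + C * γ * γ) * x * x
      + ((+ 2) * A * α * β + B * (α * δ + β * γ) + (+ 2) * C * γ * δ) * x * y
      + (A * β * β + B * β * δ + C * δ * δ) * y * y
    ≡ A * (α * x + β * y) * (α * x + β * y) + B * (α * x + β * y) * (γ * x + δ * y)
      + C * (γ * x + δ * y) * (γ * x + δ * y)
  value-· = solve-∀
  polar-· : ∀ A B C α β γ δ x y x′ y′ →
    (+ 2) * (A * α * α + B * α * γ + C * γ * γ) * x * x′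
      + ((+ 2) * A * α * β + B * (α * δ + β * γ) + (+ 2) * C * γ * δ) * (x * y′ + x′ * y)
      + (+ 2) * (A * β * β + B * β * δ + C * δ * δ) * y * y′
    ≡ (+ 2) * A * (α * x + β * y) * (α * x′ + β * y′)
      + B * ((α * x + β * y) * (γ * x′ + δ * y′) + (α * x′ + β * y′) * (γ * x + δ * y))
      + (+ 2) * C * (γ * x + δ * y) * (γ * x′ + δ * y′)
  polar-· = solve-∀

det-⊗ : ∀ h k → det (h ⊗ k) ≡ det h * det k
det-⊗ (mat α β γ δ) (mat α′ β′ γ′ δ′) = multiplicative α β γ δ α′ β′ γ′ δ′
  where
  multiplicative : ∀ α β γ δ α′ β′ γ′ δ′ →
    (α * α′ + β * γ′) * (γ * β′ + δ * δ′) - (α * β′ + β * δ′) * (γ * α′ + δ * γ′)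
    ≡ (α * δ - β * γ) * (α′ * δ′ - β′ * γ′)
  multiplicative = solve-∀

det-adj : ∀ h → det (adj h) ≡ det h
det-adj (mat α β γ δ) = symmetric α β γ δ
  where
  symmetric : ∀ α β γ δ → δ * α - (- β) * (- γ) ≡ α * δ - β * γ
  symmetric = solve-∀

adj-involutive : ∀ h → adj (adj h) ≡ h
adj-involutive (mat α β γ δ) = cong₄ mat refl (ℤₚ.neg-involutive β) (ℤₚ.neg-involutive γ) refl

adj-⊗-cancel : ∀ h k → det h ≡ 1ℤ → adj h ⊗ (h ⊗ k) ≡ k
adj-⊗-cancel (mat α β γ δ) (mat α′ β′ γ′ δ′) det≡1 =
  cong₄ mat (unit (row₁ α β γ δ α′ γ′)) (unit (row₁ α β γ δ β′ δ′))
            (unit (row₂ α β γ δ α′ γ′)) (unit (row₂ α β γ δ β′ δ′))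
  where
  unit : ∀ {i j} → i ≡ (α * δ - β * γ) * j → i ≡ j
  unit {j = j} i≡ = trans i≡ (trans (cong (_* j) det≡1) (ℤₚ.*-identityˡ j))
  row₁ : ∀ α β γ δ x y → δ * (α * x + β * y) + (- β) * (γ * x + δ * y) ≡ (α * δ - β * γ) * x
  row₁ = solve-∀
  row₂ : ∀ α β γ δ x y → (- γ) * (α * x + β * y) + α * (γ * x + δ * y) ≡ (α * δ - β * γ) * y
  row₂ = solve-∀

⊗-adj-cancel : ∀ h k → det h ≡ 1ℤ → h ⊗ (adj h ⊗ k) ≡ k
⊗-adj-cancel h k det≡1 = subst (λ h′ → h′ ⊗ (adj h ⊗ k) ≡ k) (adj-involutive h)
  (adj-⊗-cancel (adj h) k (trans (det-adj h) det≡1))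

disc-· : ∀ f h → disc (f · h) ≡ det h * det h * disc f
disc-· (form A B C) (mat α β γ δ) = invariance A B C α β γ δ
  where
  invariance : ∀ A B C α β γ δ →
    ((+ 2) * A * α * β + B * (α * δ + β * γ) + (+ 2) * C * γ * δ)
      * ((+ 2) * A * α * β + B * (α * δ + β * γ) + (+ 2) * C * γ * δ)
      - (+ 4) * (A * α * α + B * α * γ + C * γ * γ) * (A * β * β + B * β * δ + C * δ * δ)
    ≡ (α * δ - β * γ) * (α * δ - β * γ) * (B * B - (+ 4) * A * C)
  invariance = solve-∀

disc-scale : ∀ g f → disc (scale g f) ≡ g * g * disc f
disc-scale g (form a b c) = homogeneous g a b c
  where
  homogeneous : ∀ g a b c → g * b * (g * b) - (+ 4) * (g * a) * (g * c) ≡ g * g * (b * b - (+ 4) * a * c)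
  homogeneous = solve-∀

disc-opposite : ∀ f → disc (opposite f) ≡ disc f
disc-opposite (form a b c) = even a b c
  where
  even : ∀ a b c → (- b) * (- b) - (+ 4) * a * c ≡ b * b - (+ 4) * a * c
  even = solve-∀

disc-∼ : ∀ f {g} → f ∼ g → disc g ≡ disc f
disc-∼ f (h , det≡1 , refl) =
  trans (disc-· f h) (trans (cong (λ D → D * D * disc f) det≡1) (ℤₚ.*-identityˡ (disc f)))

disc-scale-neg : ∀ g f → disc (scale g f) < 0ℤ → disc f < 0ℤ
disc-scale-neg g f disc<0 with disc f ℤ.<? 0ℤ
... | yes disc-f<0 = disc-f<0
... | no  disc-f≮0 = contradiction
  (subst (0ℤ ≤_) (sym (disc-scale g f)) (nonNeg-* (square-nonNeg g) (ℤₚ.≮⇒≥ disc-f≮0)))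
  (ℤₚ.<⇒≱ disc<0)

disc<0⇒a≢0 : ∀ f → disc f < 0ℤ → a f ≢ 0ℤ
disc<0⇒a≢0 (form a b c) disc<0 refl = ℤₚ.<⇒≱ disc<0 (subst (0ℤ ≤_) (square b c) (square-nonNeg b))
  where
  square : ∀ b c → b * b ≡ b * b - (+ 4) * 0ℤ * c
  square = solve-∀

disc-determines-c : ∀ a b c c′ → a ≢ 0ℤ → disc (form a b c) ≡ disc (form a b c′) → c ≡ c′
disc-determines-c a b c c′ a≢0 disc≡ =
  ℤₚ.*-cancelˡ-≡ ((+ 4) * a) c c′ {{ℤ.≢-nonZero 4a≢0}} (begin
    (+ 4) * a * c                    ≡⟨ isolate a b c ⟩
    b * b - disc (form a b c)        ≡⟨ cong (λ D → b * b - D) disc≡ ⟩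
    b * b - disc (form a b c′)       ≡⟨ isolate a b c′ ⟨
    (+ 4) * a * c′                   ∎)
  where
  open ≡-Reasoning
  isolate : ∀ a b c → (+ 4) * a * c ≡ b * b - (b * b - (+ 4) * a * c)
  isolate = solve-∀
  4a≢0 : (+ 4) * a ≢ 0ℤ
  4a≢0 4a≡0 with ℤₚ.i*j≡0⇒i≡0∨j≡0 (+ 4) 4a≡0
  ... | inj₂ a≡0 = a≢0 a≡0

lin-scale : ∀ u v w g f → lin u v w (scale g f) ≡ g * lin u v w f
lin-scale u v w g (form a b c) = linear u v w g a b c
  where
  linear : ∀ u v w g a b c → u * (g * a) + v * (g * b) + w * (g * c) ≡ g * (u * a + v * b + w * c)
  linear = solve-∀

scale-1 : ∀ f → scale 1ℤ f ≡ f
scale-1 (form a b c) = cong₃ form (ℤₚ.*-identityˡ a) (ℤₚ.*-identityˡ b) (ℤₚ.*-identityˡ c)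

scale-scale : ∀ g h f → scale g (scale h f) ≡ scale (g * h) f
scale-scale g h (form a b c) =
  cong₃ form (sym (ℤₚ.*-assoc g h a)) (sym (ℤₚ.*-assoc g h b)) (sym (ℤₚ.*-assoc g h c))

scale-⊞ : ∀ P R T l₁ l₂ l₃ f →
  scale P (scale l₁ f) ⊞ scale R (scale l₂ f) ⊞ scale T (scale l₃ f) ≡ scale (P * l₁ + R * l₂ + T * l₃) f
scale-⊞ P R T l₁ l₂ l₃ (form a b c) =
  cong₃ form (collect P R T l₁ l₂ l₃ a) (collect P R T l₁ l₂ l₃ b) (collect P R T l₁ l₂ l₃ c)
  where
  collect : ∀ P R T l₁ l₂ l₃ a → P * (l₁ * a) + R * (l₂ * a) + T * (l₃ * a) ≡ (P * l₁ + R * l₂ + T * l₃) * a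
  collect = solve-∀

form-ext : ∀ f g → (∀ r s t → lin r s t f ≡ lin r s t g) → f ≡ g
form-ext (form a b c) (form a′ b′ c′) lin≡ = cong₃ form
  (trans (sym (pick₁ a b c)) (trans (lin≡ 1ℤ 0ℤ 0ℤ) (pick₁ a′ b′ c′)))
  (trans (sym (pick₂ a b c)) (trans (lin≡ 0ℤ 1ℤ 0ℤ) (pick₂ a′ b′ c′)))
  (trans (sym (pick₃ a b c)) (trans (lin≡ 0ℤ 0ℤ 1ℤ) (pick₃ a′ b′ c′)))
  where
  pick₁ : ∀ a b c → 1ℤ * a + 0ℤ * b + 0ℤ * c ≡ a
  pick₁ = solve-∀
  pick₂ : ∀ a b c → 0ℤ * a + 1ℤ * b + 0ℤ * c ≡ b
  pick₂ = solve-∀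
  pick₃ : ∀ a b c → 0ℤ * a + 0ℤ * b + 1ℤ * c ≡ c
  pick₃ = solve-∀

scale-injectiveʳ : ∀ k f g → k ≢ 0ℤ → scale k f ≡ scale k g → f ≡ g
scale-injectiveʳ k (form a b c) (form a′ b′ c′) k≢0 kf≡kg =
  cong₃ form (cancel (cong Form.a kf≡kg)) (cancel (cong Form.b kf≡kg)) (cancel (cong Form.c kf≡kg))
  where
  cancel : ∀ {i j} → k * i ≡ k * j → i ≡ j
  cancel = ℤₚ.*-cancelˡ-≡ k _ _ {{ℤ.≢-nonZero k≢0}}

scale-injectiveˡ : ∀ m n q → Primitive q → scale m q ≡ scale n q → m ≡ n
scale-injectiveˡ m n q (u , v , w , lin≡1) mq≡nq = begin
  m                       ≡⟨ ℤₚ.*-identityʳ m ⟨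
  m * 1ℤ                  ≡⟨ cong (m *_) lin≡1 ⟨
  m * lin u v w q         ≡⟨ lin-scale u v w m q ⟨
  lin u v w (scale m q)   ≡⟨ cong (lin u v w) mq≡nq ⟩
  lin u v w (scale n q)   ≡⟨ lin-scale u v w n q ⟩
  n * lin u v w q         ≡⟨ cong (n *_) lin≡1 ⟩
  n * 1ℤ                  ≡⟨ ℤₚ.*-identityʳ n ⟩
  n                       ∎
  where open ≡-Reasoning

content-pos : ∀ q → 0ℤ < a q → 0ℤ < content q
content-pos (form a b c) 0<a = ℤₚ.≤∧≢⇒< (+≤+ ℕ.z≤n) λ 0≡g →
  ℤₚ.<⇒≢ 0<a (sym (gcd[i,j]≡0⇒i≡0 a b (gcd[i,j]≡0⇒i≡0 (gcd a b) c (sym 0≡g))))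

primitive-part : ∀ q q₀ → 0ℤ < content q → q ≡ scale (content q) q₀ → Primitive q₀
primitive-part q q₀ 0<g q≡gq₀ =
  let u , v , w , g≡ = bézout₃ (a q) (b q) (c q) in u , v , w , unit u v w g≡
  where
  g = content q
  unit : ∀ u v w → g ≡ lin u v w q → lin u v w q₀ ≡ 1ℤ
  unit u v w g≡ = ℤₚ.*-cancelˡ-≡ g _ _ {{ℤ.≢-nonZero (ℤₚ.<⇒≢ 0<g ∘ sym)}} (begin
    g * lin u v w q₀        ≡⟨ lin-scale u v w g q₀ ⟨
    lin u v w (scale g q₀)  ≡⟨ cong (lin u v w) q≡gq₀ ⟨
    lin u v w q             ≡⟨ g≡ ⟨
    g                       ≡⟨ ℤₚ.*-identityʳ g ⟨
    g * 1ℤ                  ∎)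
    where open ≡-Reasoning

-- The lattice L'

infixl 6 _⊕_
infixl 7 _⊛_

_⊕_ : L' → L' → L'
elt x y z ⊕ elt x′ y′ z′ = elt (x + x′) (y + y′) (z + z′)

_⊛_ : ℤ → L' → L'
k ⊛ elt x y z = elt (k * x) (k * y) (k * z)

comb : L' → L' → ℤ → ℤ → L'
comb e₁ e₂ α γ = α ⊛ e₁ ⊕ γ ⊛ e₂

Q : L' → ℤ
Q (elt x y z) = x * x + y * z

⟨_,_⟩ : L' → L' → ℤ
⟨ elt x y z , elt x′ y′ z′ ⟩ = (+ 2) * x * x′ + y * z′ + z * y′

gram : L' → L' → Form
gram X Y = form (Q X) ⟨ X , Y ⟩ (Q Y)

-- pairing (assocForm X Y) Z = - det (X, Y, Z) in the coordinates (x, y, z): assocForm is a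
-- cross product and pairing the matching dot product.
pairing : Form → L' → ℤ
pairing (form a b c) (elt x y z) = b * x + a * y - c * z

QEq⇒gram : ∀ X₁ X₂ {t} → QEq X₁ X₂ t → gram X₁ X₂ ≡ t
QEq⇒gram _ _ (Q₁≡ , ⟨⟩≡ , Q₂≡) = cong₃ form Q₁≡ ⟨⟩≡ Q₂≡

gram⇒QEq : ∀ X₁ X₂ {t} → gram X₁ X₂ ≡ t → QEq X₁ X₂ t
gram⇒QEq _ _ refl = refl , refl , refl

1⊛ : ∀ X → 1ℤ ⊛ X ≡ X
1⊛ (elt x y z) = cong₃ elt (ℤₚ.*-identityˡ x) (ℤₚ.*-identityˡ y) (ℤₚ.*-identityˡ z)

⊕-0⊛ : ∀ X Y → X ⊕ 0ℤ ⊛ Y ≡ X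
⊕-0⊛ (elt x y z) _ = cong₃ elt (ℤₚ.+-identityʳ x) (ℤₚ.+-identityʳ y) (ℤₚ.+-identityʳ z)

gram-comb : ∀ e₁ e₂ h → gram (comb e₁ e₂ (α h) (γ h)) (comb e₁ e₂ (β h) (δ h)) ≡ gram e₁ e₂ · h
gram-comb (elt x y z) (elt x′ y′ z′) (mat α β γ δ) =
  cong₃ form (Q-comb x y z x′ y′ z′ α γ) (⟨⟩-comb x y z x′ y′ z′ α β γ δ) (Q-comb x y z x′ y′ z′ β δ)
  where
  Q-comb : ∀ x y z x′ y′ z′ α γ →
    (α * x + γ * x′) * (α * x + γ * x′) + (α * y + γ * y′) * (α * z + γ * z′)
    ≡ (x * x + y * z) * α * α + ((+ 2) * x * x′ + y * z′ + z * y′) * α * γ + (x′ * x′ + y′ * z′) * γ * γ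
  Q-comb = solve-∀
  ⟨⟩-comb : ∀ x y z x′ y′ z′ α β γ δ →
    (+ 2) * (α * x + γ * x′) * (β * x + δ * x′) + (α * y + γ * y′) * (β * z + δ * z′)
      + (α * z + γ * z′) * (β * y + δ * y′)
    ≡ (+ 2) * (x * x + y * z) * α * β + ((+ 2) * x * x′ + y * z′ + z * y′) * (α * δ + β * γ)
      + (+ 2) * (x′ * x′ + y′ * z′) * γ * δ
  ⟨⟩-comb = solve-∀

assocForm-comb : ∀ e₁ e₂ h →
  assocForm (comb e₁ e₂ (α h) (γ h)) (comb e₁ e₂ (β h) (δ h)) ≡ scale (det h) (assocForm e₁ e₂)
assocForm-comb (elt x y z) (elt x′ y′ z′) (mat α β γ δ) =
  cong₃ form (minor x z x′ z′ α β γ δ) (minor z y z′ y′ α β γ δ) (minor x y x′ y′ α β γ δ)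
  where
  minor : ∀ u v u′ v′ α β γ δ →
    (α * u + γ * u′) * (β * v + δ * v′) - (α * v + γ * v′) * (β * u + δ * u′)
    ≡ (α * δ - β * γ) * (u * v′ - v * u′)
  minor = solve-∀

disc-gram : ∀ X Y → disc (gram X Y) ≡ disc (assocForm X Y)
disc-gram (elt x y z) (elt x′ y′ z′) = lagrange x y z x′ y′ z′
  where
  lagrange : ∀ x y z x′ y′ z′ →
    ((+ 2) * x * x′ + y * z′ + z * y′) * ((+ 2) * x * x′ + y * z′ + z * y′)
      - (+ 4) * (x * x + y * z) * (x′ * x′ + y′ * z′)
    ≡ (z * y′ - y * z′) * (z * y′ - y * z′) - (+ 4) * (x * z′ - z * x′) * (x * y′ - y * x′)
  lagrange = solve-∀

pairing-assocFormˡ : ∀ X Y → pairing (assocForm X Y) X ≡ 0ℤ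
pairing-assocFormˡ (elt x y z) (elt x′ y′ z′) = repeated x y z x′ y′ z′
  where
  repeated : ∀ x y z x′ y′ z′ →
    (z * y′ - y * z′) * x + (x * z′ - z * x′) * y - (x * y′ - y * x′) * z ≡ 0ℤ
  repeated = solve-∀

pairing-assocFormʳ : ∀ X Y → pairing (assocForm X Y) Y ≡ 0ℤ
pairing-assocFormʳ (elt x y z) (elt x′ y′ z′) = repeated x y z x′ y′ z′
  where
  repeated : ∀ x y z x′ y′ z′ →
    (z * y′ - y * z′) * x′ + (x * z′ - z * x′) * y′ - (x * y′ - y * x′) * z′ ≡ 0ℤ
  repeated = solve-∀

pairing-scale : ∀ g q X → pairing (scale g q) X ≡ g * pairing q X
pairing-scale g (form a b c) (elt x y z) = linear g a b c x y z
  where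
  linear : ∀ g a b c x y z → g * b * x + g * a * y - g * c * z ≡ g * (b * x + a * y - c * z)
  linear = solve-∀

-- Cramer's rule for X in the frame e₁, e₂, n with n = elt v u (- w), for which
-- lin u v w (assocForm X Y) = pairing (assocForm X Y) n = - det (X, Y, n).
cramer : ∀ u v w e₁ e₂ X →
  lin u v w (assocForm e₁ e₂) ⊛ X ≡
  comb e₁ e₂ (lin u v w (assocForm X e₂)) (lin u v w (assocForm e₁ X))
    ⊕ pairing (assocForm e₁ e₂) X ⊛ elt v u (- w)
cramer u v w (elt x₁ y₁ z₁) (elt x₂ y₂ z₂) (elt x y z) =
  cong₃ elt (expand-x u v w x₁ y₁ z₁ x₂ y₂ z₂ x y z) (expand-y u v w x₁ y₁ z₁ x₂ y₂ z₂ x y z)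
            (expand-z u v w x₁ y₁ z₁ x₂ y₂ z₂ x y z)
  where
  expand-x : ∀ u v w x₁ y₁ z₁ x₂ y₂ z₂ x y z →
    let ℓ = λ x₁ y₁ z₁ x₂ y₂ z₂ → u * (x₁ * z₂ - z₁ * x₂) + v * (z₁ * y₂ - y₁ * z₂) + w * (x₁ * y₂ - y₁ * x₂)
        D = (z₁ * y₂ - y₁ * z₂) * x + (x₁ * z₂ - z₁ * x₂) * y - (x₁ * y₂ - y₁ * x₂) * z
    in ℓ x₁ y₁ z₁ x₂ y₂ z₂ * x ≡ ℓ x y z x₂ y₂ z₂ * x₁ + ℓ x₁ y₁ z₁ x y z * x₂ + D * v
  expand-x = solve-∀
  expand-y : ∀ u v w x₁ y₁ z₁ x₂ y₂ z₂ x y z →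
    let ℓ = λ x₁ y₁ z₁ x₂ y₂ z₂ → u * (x₁ * z₂ - z₁ * x₂) + v * (z₁ * y₂ - y₁ * z₂) + w * (x₁ * y₂ - y₁ * x₂)
        D = (z₁ * y₂ - y₁ * z₂) * x + (x₁ * z₂ - z₁ * x₂) * y - (x₁ * y₂ - y₁ * x₂) * z
    in ℓ x₁ y₁ z₁ x₂ y₂ z₂ * y ≡ ℓ x y z x₂ y₂ z₂ * y₁ + ℓ x₁ y₁ z₁ x y z * y₂ + D * u
  expand-y = solve-∀
  expand-z : ∀ u v w x₁ y₁ z₁ x₂ y₂ z₂ x y z →
    let ℓ = λ x₁ y₁ z₁ x₂ y₂ z₂ → u * (x₁ * z₂ - z₁ * x₂) + v * (z₁ * y₂ - y₁ * z₂) + w * (x₁ * y₂ - y₁ * x₂)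
        D = (z₁ * y₂ - y₁ * z₂) * x + (x₁ * z₂ - z₁ * x₂) * y - (x₁ * y₂ - y₁ * x₂) * z
    in ℓ x₁ y₁ z₁ x₂ y₂ z₂ * z ≡ ℓ x y z x₂ y₂ z₂ * z₁ + ℓ x₁ y₁ z₁ x y z * z₂ + D * (- w)
  expand-z = solve-∀

lin-assocForm-combˡ : ∀ u v w e₁ e₂ α γ →
  lin u v w (assocForm (comb e₁ e₂ α γ) e₂) ≡ α * lin u v w (assocForm e₁ e₂)
lin-assocForm-combˡ u v w (elt x₁ y₁ z₁) (elt x₂ y₂ z₂) α γ = linear u v w x₁ y₁ z₁ x₂ y₂ z₂ α γ
  where
  linear : ∀ u v w x₁ y₁ z₁ x₂ y₂ z₂ α γ →
    let ℓ = λ x₁ y₁ z₁ x₂ y₂ z₂ → u * (x₁ * z₂ - z₁ * x₂) + v * (z₁ * y₂ - y₁ * z₂) + w * (x₁ * y₂ - y₁ * x₂)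
    in ℓ (α * x₁ + γ * x₂) (α * y₁ + γ * y₂) (α * z₁ + γ * z₂) x₂ y₂ z₂ ≡ α * ℓ x₁ y₁ z₁ x₂ y₂ z₂
  linear = solve-∀

lin-assocForm-combʳ : ∀ u v w e₁ e₂ α γ →
  lin u v w (assocForm e₁ (comb e₁ e₂ α γ)) ≡ γ * lin u v w (assocForm e₁ e₂)
lin-assocForm-combʳ u v w (elt x₁ y₁ z₁) (elt x₂ y₂ z₂) α γ = linear u v w x₁ y₁ z₁ x₂ y₂ z₂ α γ
  where
  linear : ∀ u v w x₁ y₁ z₁ x₂ y₂ z₂ α γ →
    let ℓ = λ x₁ y₁ z₁ x₂ y₂ z₂ → u * (x₁ * z₂ - z₁ * x₂) + v * (z₁ * y₂ - y₁ * z₂) + w * (x₁ * y₂ - y₁ * x₂)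
    in ℓ x₁ y₁ z₁ (α * x₁ + γ * x₂) (α * y₁ + γ * y₂) (α * z₁ + γ * z₂) ≡ γ * ℓ x₁ y₁ z₁ x₂ y₂ z₂
  linear = solve-∀

-- Counting pairs with a given associated form

module Coordinates {u v w : ℤ} {e₁ e₂ : L'} (unimodular : lin u v w (assocForm e₁ e₂) ≡ 1ℤ) where

  coord₁ coord₂ : L' → ℤ
  coord₁ X = lin u v w (assocForm X e₂)
  coord₂ X = lin u v w (assocForm e₁ X)

  comb-coord : ∀ {X} → pairing (assocForm e₁ e₂) X ≡ 0ℤ → comb e₁ e₂ (coord₁ X) (coord₂ X) ≡ X
  comb-coord {X} X⊥ = begin
    Xᶜ                                        ≡⟨ ⊕-0⊛ Xᶜ n ⟨
    Xᶜ ⊕ 0ℤ ⊛ n                               ≡⟨ cong (λ k → Xᶜ ⊕ k ⊛ n) X⊥ ⟨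
    Xᶜ ⊕ pairing (assocForm e₁ e₂) X ⊛ n      ≡⟨ cramer u v w e₁ e₂ X ⟨
    lin u v w (assocForm e₁ e₂) ⊛ X           ≡⟨ cong (_⊛ X) unimodular ⟩
    1ℤ ⊛ X                                    ≡⟨ 1⊛ X ⟩
    X                                         ∎
    where
    open ≡-Reasoning
    Xᶜ = comb e₁ e₂ (coord₁ X) (coord₂ X)
    n = elt v u (- w)

  coord₁-comb : ∀ α γ → coord₁ (comb e₁ e₂ α γ) ≡ α
  coord₁-comb α γ =
    trans (lin-assocForm-combˡ u v w e₁ e₂ α γ) (trans (cong (α *_) unimodular) (ℤₚ.*-identityʳ α))

  coord₂-comb : ∀ α γ → coord₂ (comb e₁ e₂ α γ) ≡ γ
  coord₂-comb α γ =
    trans (lin-assocForm-combʳ u v w e₁ e₂ α γ) (trans (cong (γ *_) unimodular) (ℤₚ.*-identityʳ γ))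

  coordinates : L' → L' → Mat
  coordinates X₁ X₂ = mat (coord₁ X₁) (coord₁ X₂) (coord₂ X₁) (coord₂ X₂)

assocForm⇒pairing≡0 : ∀ g q X₁ X₂ → g ≢ 0ℤ → assocForm X₁ X₂ ≡ scale g q →
                      pairing q X₁ ≡ 0ℤ × pairing q X₂ ≡ 0ℤ
assocForm⇒pairing≡0 g q X₁ X₂ g≢0 X₁∧X₂≡gq =
  vanishes (pairing-assocFormˡ X₁ X₂) , vanishes (pairing-assocFormʳ X₁ X₂)
  where
  vanishes : ∀ {X} → pairing (assocForm X₁ X₂) X ≡ 0ℤ → pairing q X ≡ 0ℤ
  vanishes {X} X⊥ = ℤₚ.*-cancelˡ-≡ g _ 0ℤ {{ℤ.≢-nonZero g≢0}}
    (trans (sym (pairing-scale g q X)) (trans (cong (λ f → pairing f X) (sym X₁∧X₂≡gq))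
      (trans X⊥ (sym (ℤₚ.*-zeroʳ g)))))

Σ-≡-irrelevant : ∀ {A : Set} {P : A → Set} → (∀ x → Irrelevant (P x)) →
                 {p q : Σ A P} → proj₁ p ≡ proj₁ q → p ≡ q
Σ-≡-irrelevant irr {x , p} {_ , q} refl = cong (x ,_) (irr x p q)

RSet-irrelevant : ∀ f t h → Irrelevant ((t ≡ f · h) × (0ℤ < det h))
RSet-irrelevant f t h (e , p) (e′ , p′) = cong₂ _,_ (≡-irrelevantᶠ e e′) (ℤₚ.<-irrelevant p p′)

MSet-≡ : ∀ t q {X₁ X₂ X₁′ X₂′} {p : QEq X₁ X₂ t × (assocForm X₁ X₂ ≡ q)}
         {p′ : QEq X₁′ X₂′ t × (assocForm X₁′ X₂′ ≡ q)} →
         X₁ ≡ X₁′ → X₂ ≡ X₂′ → _≡_ {A = MSet t q} (X₁ , X₂ , p) (X₁′ , X₂′ , p′)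
MSet-≡ _ _ {p = (e₁ , e₂ , e₃) , r} {(e₁′ , e₂′ , e₃′) , r′} refl refl =
  cong₄ (λ x y z w → _ , _ , (x , y , z) , w)
    (≡-irrelevantℤ e₁ e₁′) (≡-irrelevantℤ e₂ e₂′) (≡-irrelevantℤ e₃ e₃′) (≡-irrelevantᶠ r r′)

MSet↔RSet : ∀ e₁ e₂ q₀ g t → assocForm e₁ e₂ ≡ q₀ → Primitive q₀ → disc q₀ ≢ 0ℤ → 0ℤ < g →
            disc t ≡ disc (scale g q₀) → MSet t (scale g q₀) ↔ RSet (gram e₁ e₂) t
MSet↔RSet e₁ e₂ q₀ g t basis prim@(u , v , w , lin≡1) disc≢0 0<g disc-t =
  mk↔ₛ′ to from to∘from from∘to
  where
  open Coordinates {u} {v} {w} {e₁} {e₂} (trans (cong (lin u v w) basis) lin≡1)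

  disc-gram≡ : disc (gram e₁ e₂) ≡ disc q₀
  disc-gram≡ = trans (disc-gram e₁ e₂) (cong disc basis)

  in-span : ∀ X₁ X₂ → assocForm X₁ X₂ ≡ scale g q₀ →
            comb e₁ e₂ (coord₁ X₁) (coord₂ X₁) ≡ X₁ × comb e₁ e₂ (coord₁ X₂) (coord₂ X₂) ≡ X₂
  in-span X₁ X₂ X₁∧X₂≡gq₀ =
    let X₁⊥ , X₂⊥ = assocForm⇒pairing≡0 g q₀ X₁ X₂ (ℤₚ.<⇒≢ 0<g ∘ sym) X₁∧X₂≡gq₀
        ⊥-basis = λ {X} (X⊥ : pairing q₀ X ≡ 0ℤ) → trans (cong (λ f → pairing f X) basis) X⊥
    in comb-coord (⊥-basis X₁⊥) , comb-coord (⊥-basis X₂⊥)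

  positive-det≡g : ∀ {h} → 0ℤ < det h → t ≡ gram e₁ e₂ · h → det h ≡ g
  positive-det≡g {h} 0<det t≡ =
    square-injective-pos 0<det 0<g (ℤₚ.*-cancelʳ-≡ _ _ (disc q₀) {{ℤ.≢-nonZero disc≢0}} (begin
    det h * det h * disc q₀             ≡⟨ cong (λ D → det h * det h * D) disc-gram≡ ⟨
    det h * det h * disc (gram e₁ e₂)   ≡⟨ disc-· (gram e₁ e₂) h ⟨
    disc (gram e₁ e₂ · h)               ≡⟨ cong disc t≡ ⟨
    disc t                              ≡⟨ disc-t ⟩
    disc (scale g q₀)                   ≡⟨ disc-scale g q₀ ⟩
    g * g * disc q₀                     ∎))
    where open ≡-Reasoning

  to : MSet t (scale g q₀) → RSet (gram e₁ e₂) t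
  to (X₁ , X₂ , Q≡t , X₁∧X₂≡gq₀) = h , t≡ , subst (0ℤ <_) (sym det-h≡g) 0<g
    where
    h = coordinates X₁ X₂
    X₁≡ = proj₁ (in-span X₁ X₂ X₁∧X₂≡gq₀)
    X₂≡ = proj₂ (in-span X₁ X₂ X₁∧X₂≡gq₀)
    t≡ : t ≡ gram e₁ e₂ · h
    t≡ = trans (sym (QEq⇒gram X₁ X₂ Q≡t)) (trans (cong₂ gram (sym X₁≡) (sym X₂≡)) (gram-comb e₁ e₂ h))
    det-h≡g : det h ≡ g
    det-h≡g = scale-injectiveˡ (det h) g q₀ prim (begin
      scale (det h) q₀                 ≡⟨ cong (scale (det h)) basis ⟨
      scale (det h) (assocForm e₁ e₂)  ≡⟨ assocForm-comb e₁ e₂ h ⟨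
      assocForm (comb e₁ e₂ (α h) (γ h)) (comb e₁ e₂ (β h) (δ h)) ≡⟨ cong₂ assocForm X₁≡ X₂≡ ⟩
      assocForm X₁ X₂                  ≡⟨ X₁∧X₂≡gq₀ ⟩
      scale g q₀                       ∎)
      where open ≡-Reasoning

  from : RSet (gram e₁ e₂) t → MSet t (scale g q₀)
  from (h , t≡ , 0<det) =
    X₁ , X₂ , gram⇒QEq X₁ X₂ (trans (gram-comb e₁ e₂ h) (sym t≡)) ,
    trans (assocForm-comb e₁ e₂ h) (cong₂ scale (positive-det≡g 0<det t≡) basis)
    where
    X₁ = comb e₁ e₂ (α h) (γ h)
    X₂ = comb e₁ e₂ (β h) (δ h)

  to∘from : ∀ r → to (from r) ≡ r
  to∘from (mat α β γ δ , _) = Σ-≡-irrelevant (RSet-irrelevant (gram e₁ e₂) t)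
    (cong₄ mat (coord₁-comb α γ) (coord₁-comb β δ) (coord₂-comb α γ) (coord₂-comb β δ))

  from∘to : ∀ m → from (to m) ≡ m
  from∘to (X₁ , X₂ , _ , X₁∧X₂≡gq₀) =
    let X₁≡ , X₂≡ = in-span X₁ X₂ X₁∧X₂≡gq₀ in MSet-≡ t (scale g q₀) X₁≡ X₂≡

RSet-· : ∀ f h t → det h ≡ 1ℤ → RSet (f · h) t ↔ RSet f t
RSet-· f h t det≡1 = mk↔ₛ′ to from to∘from from∘to
  where
  to : RSet (f · h) t → RSet f t
  to (k , t≡ , 0<det) = h ⊗ k , trans t≡ (·-⊗ f h k) , subst (0ℤ <_) (sym det-h⊗) 0<det
    where
    det-h⊗ : det (h ⊗ k) ≡ det k
    det-h⊗ = trans (det-⊗ h k) (trans (cong (_* det k) det≡1) (ℤₚ.*-identityˡ (det k)))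

  from : RSet f t → RSet (f · h) t
  from (k , t≡ , 0<det) = adj h ⊗ k , t≡′ , subst (0ℤ <_) (sym det-adj⊗) 0<det
    where
    t≡′ : t ≡ (f · h) · (adj h ⊗ k)
    t≡′ = trans t≡ (trans (cong (f ·_) (sym (⊗-adj-cancel h k det≡1))) (sym (·-⊗ f h (adj h ⊗ k))))
    det-adj⊗ : det (adj h ⊗ k) ≡ det k
    det-adj⊗ = trans (det-⊗ (adj h) k)
                     (trans (cong (_* det k) (trans (det-adj h) det≡1)) (ℤₚ.*-identityˡ (det k)))

  to∘from : ∀ r → to (from r) ≡ r
  to∘from (k , _) = Σ-≡-irrelevant (RSet-irrelevant f t) (⊗-adj-cancel h k det≡1)

  from∘to : ∀ r → from (to r) ≡ r
  from∘to (k , _) = Σ-≡-irrelevant (RSet-irrelevant (f · h) t) (adj-⊗-cancel h k det≡1)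

RSet-∼ : ∀ f {p} t → f ∼ p → RSet f t ↔ RSet p t
RSet-∼ f t (h , det≡1 , refl) = ↔-sym (RSet-· f h t det≡1)

-- Finiteness of the representation sets of a definite form

Finite : Set → Set
Finite A = ∃ (HasCard A)

finite-↔ : ∀ {A B} → A ↔ B → Finite A → Finite B
finite-↔ A↔B (n , Fin↔A) = n , ↔-trans Fin↔A A↔B

finite-⊎ : ∀ {A B} → Finite A → Finite B → Finite (A ⊎ B)
finite-⊎ (m , Fin↔A) (n , Fin↔B) = m ℕ.+ n , ↔-trans Finₚ.+↔⊎ (Fin↔A ⊎-↔ Fin↔B)

finite-× : ∀ {A B} → Finite A → Finite B → Finite (A × B)
finite-× (m , Fin↔A) (n , Fin↔B) = m ℕ.* n , ↔-trans Finₚ.*↔× (Fin↔A ×-↔ Fin↔B)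

finite-Dec : ∀ {P : Set} → Dec P → Irrelevant P → Finite P
finite-Dec (yes p) irr = 1 , mk↔ₛ′ (λ _ → p) (λ _ → Fin.zero) (irr p) (λ { Fin.zero → refl ; (Fin.suc ()) })
finite-Dec (no ¬p) _   = 0 , mk↔ₛ′ (λ ()) (λ p → contradiction p ¬p) (λ p → contradiction p ¬p) (λ ())

Σ-Fin-suc↔ : ∀ {n} (P : Fin (ℕ.suc n) → Set) → (P Fin.zero ⊎ Σ (Fin n) (P ∘ Fin.suc)) ↔ Σ (Fin (ℕ.suc n)) P
Σ-Fin-suc↔ P = mk↔ₛ′ to from to∘from from∘to
  where
  to : (P Fin.zero ⊎ Σ _ (P ∘ Fin.suc)) → Σ _ P
  to (inj₁ p)       = Fin.zero , p
  to (inj₂ (i , p)) = Fin.suc i , p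
  from : Σ _ P → (P Fin.zero ⊎ Σ _ (P ∘ Fin.suc))
  from (Fin.zero , p)  = inj₁ p
  from (Fin.suc i , p) = inj₂ (i , p)
  to∘from : ∀ x → to (from x) ≡ x
  to∘from (Fin.zero , p)  = refl
  to∘from (Fin.suc i , p) = refl
  from∘to : ∀ x → from (to x) ≡ x
  from∘to (inj₁ p)       = refl
  from∘to (inj₂ (i , p)) = refl

finite-ΣFin : ∀ n {P : Fin n → Set} → Decidable P → (∀ i → Irrelevant (P i)) → Finite (Σ (Fin n) P)
finite-ΣFin ℕ.zero    _  _   = 0 , mk↔ₛ′ (λ ()) (λ { (() , _) }) (λ { (() , _) }) (λ ())
finite-ΣFin (ℕ.suc n) P? irr = finite-↔ (Σ-Fin-suc↔ _)
  (finite-⊎ (finite-Dec (P? Fin.zero) (irr Fin.zero)) (finite-ΣFin n (P? ∘ Fin.suc) (irr ∘ Fin.suc)))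

finite-Σ : ∀ {A : Set} {P : A → Set} → Finite A → Decidable P → (∀ x → Irrelevant (P x)) → Finite (Σ A P)
finite-Σ (n , Fin↔A) P? irr =
  finite-↔ (Σ-↔ Fin↔A ↔-refl) (finite-ΣFin n (P? ∘ Inverse.to Fin↔A) (irr ∘ Inverse.to Fin↔A))

Bounded : ℕ → Set
Bounded n = Σ ℤ λ i → ∣ i ∣ ℕ.≤ n

finite-Bounded : ∀ n → Finite (Bounded n)
finite-Bounded n = ℕ.suc n ℕ.+ n , ↔-trans Finₚ.+↔⊎ (mk↔ₛ′ to from to∘from from∘to)
  where
  to : Fin (ℕ.suc n) ⊎ Fin n → Bounded n
  to (inj₁ k) = + toℕ k , ℕ.s≤s⁻¹ (Finₚ.toℕ<n k)
  to (inj₂ k) = -[1+ toℕ k ] , Finₚ.toℕ<n k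
  from : Bounded n → Fin (ℕ.suc n) ⊎ Fin n
  from (+ m , m≤n)      = inj₁ (fromℕ< (ℕ.s≤s m≤n))
  from (-[1+ m ] , m<n) = inj₂ (fromℕ< m<n)
  Bounded-≡ : ∀ {i j} {p : ∣ i ∣ ℕ.≤ n} {q : ∣ j ∣ ℕ.≤ n} → i ≡ j → _≡_ {A = Bounded n} (i , p) (j , q)
  Bounded-≡ {i} {p = p} {q} refl = cong (i ,_) (ℕₚ.≤-irrelevant p q)
  to∘from : ∀ b → to (from b) ≡ b
  to∘from (+ m , m≤n)      = Bounded-≡ (cong +_ (Finₚ.toℕ-fromℕ< (ℕ.s≤s m≤n)))
  to∘from (-[1+ m ] , m<n) = Bounded-≡ (cong -[1+_] (Finₚ.toℕ-fromℕ< m<n))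
  from∘to : ∀ k → from (to k) ≡ k
  from∘to (inj₁ k) = cong inj₁ (Finₚ.fromℕ<-toℕ k _)
  from∘to (inj₂ k) = cong inj₂ (Finₚ.fromℕ<-toℕ k _)

-- 4a·f(x, y) = (2ax + by)² - disc f·y², so for disc f < 0 each y is bounded by |4a·f(x, y)|.
coordinate-boundʳ : ∀ f x y → disc f < 0ℤ → ∣ y ∣ ℕ.≤ ∣ (+ 4) * a f * value f (x , y) ∣
coordinate-boundʳ (form A B C) x y disc<0 = ℤₚ.drop‿+≤+ (begin
  + ∣ y ∣                         ≤⟨ ∣i∣≤i*i y ⟩
  y * y                           ≡⟨ ℤₚ.*-identityˡ (y * y) ⟨
  1ℤ * (y * y)                    ≤⟨ ℤₚ.*-monoʳ-≤-nonNeg (y * y) {{ℤ.nonNegative (square-nonNeg y)}} 1≤N ⟩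
  N * (y * y)                     ≤⟨ ℤₚ.i≤j+i (N * (y * y)) (s * s) {{ℤ.nonNegative (square-nonNeg s)}} ⟩
  s * s + N * (y * y)             ≡⟨ complete-square A B C x y ⟨
  (+ 4) * A * value (form A B C) (x , y)       ≤⟨ i≤+∣i∣ _ ⟩
  + ∣ (+ 4) * A * value (form A B C) (x , y) ∣ ∎)
  where
  open ℤₚ.≤-Reasoning
  N = - disc (form A B C)
  s = (+ 2) * A * x + B * y
  1≤N : 1ℤ ≤ N
  1≤N = ℤₚ.i<j⇒suc[i]≤j (ℤₚ.neg-mono-< disc<0)
  complete-square : ∀ A B C x y →
    (+ 4) * A * (A * x * x + B * x * y + C * y * y)
    ≡ ((+ 2) * A * x + B * y) * ((+ 2) * A * x + B * y) + - (B * B - (+ 4) * A * C) * (y * y)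
  complete-square = solve-∀

coordinate-boundˡ : ∀ f x y → disc f < 0ℤ → ∣ x ∣ ℕ.≤ ∣ (+ 4) * c f * value f (x , y) ∣
coordinate-boundˡ (form A B C) x y disc<0 =
  subst (λ v → ∣ x ∣ ℕ.≤ ∣ (+ 4) * C * v ∣) (swap A B C x y)
        (coordinate-boundʳ (form C B A) y x (subst (_< 0ℤ) (disc-swap A B C) disc<0))
  where
  swap : ∀ A B C x y → C * y * y + B * y * x + A * x * x ≡ A * x * x + B * x * y + C * y * y
  swap = solve-∀
  disc-swap : ∀ A B C → B * B - (+ 4) * A * C ≡ B * B - (+ 4) * C * A
  disc-swap = solve-∀

finite-RSet : ∀ f t → disc f < 0ℤ → Finite (RSet f t)
finite-RSet f t disc<0 = finite-↔ (mk↔ₛ′ from to (λ _ → refl) to∘from)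
  (finite-Σ (finite-× (finite-Bounded _)
               (finite-× (finite-Bounded _) (finite-× (finite-Bounded _) (finite-Bounded _))))
            (λ b → (t ≟ᶠ f · matrix b) ×-dec (0ℤ ℤₚ.<? det (matrix b)))
            (RSet-irrelevant f t ∘ matrix))
  where
  Box = Bounded ∣ (+ 4) * c f * a t ∣ × Bounded ∣ (+ 4) * c f * c t ∣ ×
        Bounded ∣ (+ 4) * a f * a t ∣ × Bounded ∣ (+ 4) * a f * c t ∣
  matrix : Box → Mat
  matrix ((α , _) , (β , _) , (γ , _) , (δ , _)) = mat α β γ δ
  Box-≡ : ∀ {b b′} → matrix b ≡ matrix b′ → b ≡ b′
  Box-≡ {(_ , p₁) , (_ , p₂) , (_ , p₃) , (_ , p₄)} {(_ , q₁) , (_ , q₂) , (_ , q₃) , (_ , q₄)} refl =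
    cong₄ (λ p₁ p₂ p₃ p₄ → (_ , p₁) , (_ , p₂) , (_ , p₃) , (_ , p₄))
      (ℕₚ.≤-irrelevant p₁ q₁) (ℕₚ.≤-irrelevant p₂ q₂) (ℕₚ.≤-irrelevant p₃ q₃) (ℕₚ.≤-irrelevant p₄ q₄)
  P : Box → Set
  P b = (t ≡ f · matrix b) × (0ℤ < det (matrix b))
  to : RSet f t → Σ Box P
  to (h , t≡ , 0<det) = ((α h , bound-α) , (β h , bound-β) , (γ h , bound-γ) , (δ h , bound-δ)) , t≡ , 0<det
    where
    at = sym (cong a t≡)
    ct = sym (cong c t≡)
    bound-α = subst (λ v → ∣ α h ∣ ℕ.≤ ∣ (+ 4) * c f * v ∣) at (coordinate-boundˡ f (α h) (γ h) disc<0)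
    bound-γ = subst (λ v → ∣ γ h ∣ ℕ.≤ ∣ (+ 4) * a f * v ∣) at (coordinate-boundʳ f (α h) (γ h) disc<0)
    bound-β = subst (λ v → ∣ β h ∣ ℕ.≤ ∣ (+ 4) * c f * v ∣) ct (coordinate-boundˡ f (β h) (δ h) disc<0)
    bound-δ = subst (λ v → ∣ δ h ∣ ℕ.≤ ∣ (+ 4) * a f * v ∣) ct (coordinate-boundʳ f (β h) (δ h) disc<0)
  from : Σ Box P → RSet f t
  from (b , p) = matrix b , p
  to∘from : ∀ x → to (from x) ≡ x
  to∘from _ = Σ-≡-irrelevant (RSet-irrelevant f t ∘ matrix) (Box-≡ refl)

-- Dirichlet composition inside L'

-- A symmetric bilinear map into the kernel of pairing q with Q (μ q u v) = q′(u) q′(v) for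
-- q′ = opposite q: it realises the composition of q′ with itself, and supplies the basis in DirichletBasis.
μ : Form → ℤ × ℤ → ℤ × ℤ → L'
μ (form a b c) (x₁ , y₁) (x₂ , y₂) =
  elt (a * x₁ * x₂ - c * y₁ * y₂) (c * (x₁ * y₂ + y₁ * x₂) - b * x₁ * x₂) (a * (x₁ * y₂ + y₁ * x₂) - b * y₁ * y₂)

Q-μ : ∀ q u v → Q (μ q u v) ≡ value (opposite q) u * value (opposite q) v
Q-μ (form a b c) (x₁ , y₁) (x₂ , y₂) = multiplicative a b c x₁ y₁ x₂ y₂
  where
  multiplicative : ∀ a b c x₁ y₁ x₂ y₂ →
    let q′ = λ x y → a * x * x + (- b) * x * y + c * y * y
        X = a * x₁ * x₂ - c * y₁ * y₂
        Y = c * (x₁ * y₂ + y₁ * x₂) - b * x₁ * x₂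
        Z = a * (x₁ * y₂ + y₁ * x₂) - b * y₁ * y₂
    in X * X + Y * Z ≡ q′ x₁ y₁ * q′ x₂ y₂
  multiplicative = solve-∀

⟨μ,μ⟩ʳ : ∀ q u v v′ → ⟨ μ q u v , μ q u v′ ⟩ ≡ value (opposite q) u * polar (opposite q) v v′
⟨μ,μ⟩ʳ (form a b c) (x₁ , y₁) (x₂ , y₂) (x₃ , y₃) = polarised a b c x₁ y₁ x₂ y₂ x₃ y₃
  where
  polarised : ∀ a b c x₁ y₁ x₂ y₂ x₃ y₃ →
    let q′ = λ x y → a * x * x + (- b) * x * y + c * y * y
        B′ = λ x y x′ y′ → (+ 2) * a * x * x′ + (- b) * (x * y′ + x′ * y) + (+ 2) * c * y * y′
        X = λ x₁ y₁ x₂ y₂ → a * x₁ * x₂ - c * y₁ * y₂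
        Y = λ x₁ y₁ x₂ y₂ → c * (x₁ * y₂ + y₁ * x₂) - b * x₁ * x₂
        Z = λ x₁ y₁ x₂ y₂ → a * (x₁ * y₂ + y₁ * x₂) - b * y₁ * y₂
    in (+ 2) * X x₁ y₁ x₂ y₂ * X x₁ y₁ x₃ y₃ + Y x₁ y₁ x₂ y₂ * Z x₁ y₁ x₃ y₃ + Z x₁ y₁ x₂ y₂ * Y x₁ y₁ x₃ y₃
       ≡ q′ x₁ y₁ * B′ x₂ y₂ x₃ y₃
  polarised = solve-∀

⟨μ,μ⟩ˡ : ∀ q u v u′ → ⟨ μ q u v , μ q u′ v ⟩ ≡ value (opposite q) v * polar (opposite q) u u′
⟨μ,μ⟩ˡ (form a b c) (x₁ , y₁) (x₂ , y₂) (x₃ , y₃) = polarised a b c x₁ y₁ x₂ y₂ x₃ y₃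
  where
  polarised : ∀ a b c x₁ y₁ x₂ y₂ x₃ y₃ →
    let q′ = λ x y → a * x * x + (- b) * x * y + c * y * y
        B′ = λ x y x′ y′ → (+ 2) * a * x * x′ + (- b) * (x * y′ + x′ * y) + (+ 2) * c * y * y′
        X = λ x₁ y₁ x₂ y₂ → a * x₁ * x₂ - c * y₁ * y₂
        Y = λ x₁ y₁ x₂ y₂ → c * (x₁ * y₂ + y₁ * x₂) - b * x₁ * x₂
        Z = λ x₁ y₁ x₂ y₂ → a * (x₁ * y₂ + y₁ * x₂) - b * y₁ * y₂
    in (+ 2) * X x₁ y₁ x₂ y₂ * X x₃ y₃ x₂ y₂ + Y x₁ y₁ x₂ y₂ * Z x₃ y₃ x₂ y₂ + Z x₁ y₁ x₂ y₂ * Y x₃ y₃ x₂ y₂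
       ≡ q′ x₂ y₂ * B′ x₁ y₁ x₃ y₃
  polarised = solve-∀

⟨μ,μ⟩ : ∀ q u v u′ v′ → (+ 2) * ⟨ μ q u v , μ q u′ v′ ⟩ ≡
        polar (opposite q) u u′ * polar (opposite q) v v′ + disc q * det₂ u u′ * det₂ v v′
⟨μ,μ⟩ (form a b c) (x₁ , y₁) (x₂ , y₂) (x₃ , y₃) (x₄ , y₄) = polarised a b c x₁ y₁ x₂ y₂ x₃ y₃ x₄ y₄
  where
  polarised : ∀ a b c x₁ y₁ x₂ y₂ x₃ y₃ x₄ y₄ →
    let B′ = λ x y x′ y′ → (+ 2) * a * x * x′ + (- b) * (x * y′ + x′ * y) + (+ 2) * c * y * y′
        d = λ x y x′ y′ → x * y′ - x′ * y
        X = λ x₁ y₁ x₂ y₂ → a * x₁ * x₂ - c * y₁ * y₂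
        Y = λ x₁ y₁ x₂ y₂ → c * (x₁ * y₂ + y₁ * x₂) - b * x₁ * x₂
        Z = λ x₁ y₁ x₂ y₂ → a * (x₁ * y₂ + y₁ * x₂) - b * y₁ * y₂
    in (+ 2) * ((+ 2) * X x₁ y₁ x₂ y₂ * X x₃ y₃ x₄ y₄ + Y x₁ y₁ x₂ y₂ * Z x₃ y₃ x₄ y₄
                + Z x₁ y₁ x₂ y₂ * Y x₃ y₃ x₄ y₄)
       ≡ B′ x₁ y₁ x₃ y₃ * B′ x₂ y₂ x₄ y₄ + (b * b - (+ 4) * a * c) * d x₁ y₁ x₃ y₃ * d x₂ y₂ x₄ y₄
  polarised = solve-∀

assocForm-μʳ : ∀ q u v v′ → assocForm (μ q u v) (μ q u v′) ≡ scale (value (opposite q) u * det₂ v v′) q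
assocForm-μʳ (form a b c) (x₁ , y₁) (x₂ , y₂) (x₃ , y₃) =
  form-ext _ _ λ r s t → cross r s t a b c x₁ y₁ x₂ y₂ x₃ y₃
  where
  cross : ∀ r s t a b c x₁ y₁ x₂ y₂ x₃ y₃ →
    let q′ = λ x y → a * x * x + (- b) * x * y + c * y * y
        d = λ x y x′ y′ → x * y′ - x′ * y
        X = λ x₁ y₁ x₂ y₂ → a * x₁ * x₂ - c * y₁ * y₂
        Y = λ x₁ y₁ x₂ y₂ → c * (x₁ * y₂ + y₁ * x₂) - b * x₁ * x₂
        Z = λ x₁ y₁ x₂ y₂ → a * (x₁ * y₂ + y₁ * x₂) - b * y₁ * y₂
        S = q′ x₁ y₁ * d x₂ y₂ x₃ y₃
    in r * (X x₁ y₁ x₂ y₂ * Z x₁ y₁ x₃ y₃ - Z x₁ y₁ x₂ y₂ * X x₁ y₁ x₃ y₃)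
       + s * (Z x₁ y₁ x₂ y₂ * Y x₁ y₁ x₃ y₃ - Y x₁ y₁ x₂ y₂ * Z x₁ y₁ x₃ y₃)
       + t * (X x₁ y₁ x₂ y₂ * Y x₁ y₁ x₃ y₃ - Y x₁ y₁ x₂ y₂ * X x₁ y₁ x₃ y₃)
       ≡ r * (S * a) + s * (S * b) + t * (S * c)
  cross = solve-∀

assocForm-μˡ : ∀ q u v u′ → assocForm (μ q u v) (μ q u′ v) ≡ scale (value (opposite q) v * det₂ u u′) q
assocForm-μˡ (form a b c) (x₁ , y₁) (x₂ , y₂) (x₃ , y₃) =
  form-ext _ _ λ r s t → cross r s t a b c x₁ y₁ x₂ y₂ x₃ y₃
  where
  cross : ∀ r s t a b c x₁ y₁ x₂ y₂ x₃ y₃ →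
    let q′ = λ x y → a * x * x + (- b) * x * y + c * y * y
        d = λ x y x′ y′ → x * y′ - x′ * y
        X = λ x₁ y₁ x₂ y₂ → a * x₁ * x₂ - c * y₁ * y₂
        Y = λ x₁ y₁ x₂ y₂ → c * (x₁ * y₂ + y₁ * x₂) - b * x₁ * x₂
        Z = λ x₁ y₁ x₂ y₂ → a * (x₁ * y₂ + y₁ * x₂) - b * y₁ * y₂
        S = q′ x₂ y₂ * d x₁ y₁ x₃ y₃
    in r * (X x₁ y₁ x₂ y₂ * Z x₃ y₃ x₂ y₂ - Z x₁ y₁ x₂ y₂ * X x₃ y₃ x₂ y₂)
       + s * (Z x₁ y₁ x₂ y₂ * Y x₃ y₃ x₂ y₂ - Y x₁ y₁ x₂ y₂ * Z x₃ y₃ x₂ y₂)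
       + t * (X x₁ y₁ x₂ y₂ * Y x₃ y₃ x₂ y₂ - Y x₁ y₁ x₂ y₂ * X x₃ y₃ x₂ y₂)
       ≡ r * (S * a) + s * (S * b) + t * (S * c)
  cross = solve-∀

assocForm-μ : ∀ q u v u′ v′ → scale (+ 2) (assocForm (μ q u v) (μ q u′ v′)) ≡
              scale (polar (opposite q) u u′ * det₂ v v′ + polar (opposite q) v v′ * det₂ u u′) q
assocForm-μ (form a b c) (x₁ , y₁) (x₂ , y₂) (x₃ , y₃) (x₄ , y₄) =
  form-ext _ _ λ r s t → cross r s t a b c x₁ y₁ x₂ y₂ x₃ y₃ x₄ y₄
  where
  cross : ∀ r s t a b c x₁ y₁ x₂ y₂ x₃ y₃ x₄ y₄ →
    let B′ = λ x y x′ y′ → (+ 2) * a * x * x′ + (- b) * (x * y′ + x′ * y) + (+ 2) * c * y * y′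
        d = λ x y x′ y′ → x * y′ - x′ * y
        X = λ x₁ y₁ x₂ y₂ → a * x₁ * x₂ - c * y₁ * y₂
        Y = λ x₁ y₁ x₂ y₂ → c * (x₁ * y₂ + y₁ * x₂) - b * x₁ * x₂
        Z = λ x₁ y₁ x₂ y₂ → a * (x₁ * y₂ + y₁ * x₂) - b * y₁ * y₂
        S = B′ x₁ y₁ x₃ y₃ * d x₂ y₂ x₄ y₄ + B′ x₂ y₂ x₄ y₄ * d x₁ y₁ x₃ y₃
    in r * ((+ 2) * (X x₁ y₁ x₂ y₂ * Z x₃ y₃ x₄ y₄ - Z x₁ y₁ x₂ y₂ * X x₃ y₃ x₄ y₄))
       + s * ((+ 2) * (Z x₁ y₁ x₂ y₂ * Y x₃ y₃ x₄ y₄ - Y x₁ y₁ x₂ y₂ * Z x₃ y₃ x₄ y₄))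
       + t * ((+ 2) * (X x₁ y₁ x₂ y₂ * Y x₃ y₃ x₄ y₄ - Y x₁ y₁ x₂ y₂ * X x₃ y₃ x₄ y₄))
       ≡ r * (S * a) + s * (S * b) + t * (S * c)
  cross = solve-∀

assocForm-combʳ : ∀ X A B C P R T k →
  assocForm X (P ⊛ A ⊕ R ⊛ B ⊕ T ⊛ C ⊕ k ⊛ X) ≡
  scale P (assocForm X A) ⊞ scale R (assocForm X B) ⊞ scale T (assocForm X C)
assocForm-combʳ (elt x y z) (elt x₁ y₁ z₁) (elt x₂ y₂ z₂) (elt x₃ y₃ z₃) P R T k =
  cong₃ form (minor x z x₁ z₁ x₂ z₂ x₃ z₃ P R T k) (minor z y z₁ y₁ z₂ y₂ z₃ y₃ P R T k)
             (minor x y x₁ y₁ x₂ y₂ x₃ y₃ P R T k)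
  where
  minor : ∀ u v u₁ v₁ u₂ v₂ u₃ v₃ P R T k →
    u * (P * v₁ + R * v₂ + T * v₃ + k * v) - v * (P * u₁ + R * u₂ + T * u₃ + k * u)
    ≡ P * (u * v₁ - v * u₁) + R * (u * v₂ - v * u₂) + T * (u * v₃ - v * u₃)
  minor = solve-∀

⟨⟩-combʳ : ∀ X A B C P R T k →
  ⟨ X , P ⊛ A ⊕ R ⊛ B ⊕ T ⊛ C ⊕ k ⊛ X ⟩ ≡ P * ⟨ X , A ⟩ + R * ⟨ X , B ⟩ + T * ⟨ X , C ⟩ + k * ((+ 2) * Q X)
⟨⟩-combʳ (elt x y z) (elt x₁ y₁ z₁) (elt x₂ y₂ z₂) (elt x₃ y₃ z₃) P R T k =
  linear x y z x₁ y₁ z₁ x₂ y₂ z₂ x₃ y₃ z₃ P R T k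
  where
  linear : ∀ x y z x₁ y₁ z₁ x₂ y₂ z₂ x₃ y₃ z₃ P R T k →
    let B = λ x′ y′ z′ → (+ 2) * x * x′ + y * z′ + z * y′
    in B (P * x₁ + R * x₂ + T * x₃ + k * x) (P * y₁ + R * y₂ + T * y₃ + k * y) (P * z₁ + R * z₂ + T * z₃ + k * z)
       ≡ P * B x₁ y₁ z₁ + R * B x₂ y₂ z₂ + T * B x₃ y₃ z₃ + k * ((+ 2) * (x * x + y * z))
  linear = solve-∀

dirichlet-middle-coefficient : ∀ a₁ a₂ b₁ b₂ b₃ c₃ m₁ m₂ e P R T G →
  b₁ ≡ b₃ - m₁ * ((+ 2) * a₁) → b₂ ≡ b₃ - m₂ * ((+ 2) * a₂) →
  P * a₁ + R * a₂ + T * e ≡ 1ℤ → b₁ + b₂ ≡ (+ 2) * e →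
  (+ 2) * G ≡ b₁ * b₂ + (b₃ * b₃ - (+ 4) * (a₁ * a₂) * c₃) →
  P * (a₁ * b₂) + R * (a₂ * b₁) + T * G + (P * m₂ + R * m₁ + T * (c₃ - m₁ * m₂)) * ((+ 2) * (a₁ * a₂)) ≡ b₃
dirichlet-middle-coefficient a₁ a₂ b₁ b₂ b₃ c₃ m₁ m₂ e P R T G refl refl PRT≡1 b₁+b₂≡ 2G≡ =
  ℤₚ.*-cancelˡ-≡ (+ 2) _ _ (begin
    (+ 2) * (P * (a₁ * b₂) + R * (a₂ * b₁) + T * G + k * ((+ 2) * (a₁ * a₂)))
      ≡⟨ expand a₁ a₂ b₃ c₃ m₁ m₂ P R T G ⟩
    (+ 2) * b₃ * (P * a₁ + R * a₂) + T * ((+ 2) * G) - T * (b₁ * b₂ + D) + T * b₃ * (b₁ + b₂)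
      ≡⟨ cong₂ (λ G₂ S → (+ 2) * b₃ * (P * a₁ + R * a₂) + T * G₂ - T * (b₁ * b₂ + D) + T * b₃ * S) 2G≡ b₁+b₂≡ ⟩
    (+ 2) * b₃ * (P * a₁ + R * a₂) + T * (b₁ * b₂ + D) - T * (b₁ * b₂ + D) + T * b₃ * ((+ 2) * e)
      ≡⟨ collect b₃ P a₁ R a₂ T (b₁ * b₂ + D) e ⟩
    (+ 2) * b₃ * (P * a₁ + R * a₂ + T * e)
      ≡⟨ cong (λ u → (+ 2) * b₃ * u) PRT≡1 ⟩
    (+ 2) * b₃ * 1ℤ
      ≡⟨ ℤₚ.*-identityʳ _ ⟩
    (+ 2) * b₃ ∎)
  where
  open ≡-Reasoning
  k = P * m₂ + R * m₁ + T * (c₃ - m₁ * m₂)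
  D = b₃ * b₃ - (+ 4) * (a₁ * a₂) * c₃
  expand : ∀ a₁ a₂ b₃ c₃ m₁ m₂ P R T G →
    let b₁ = b₃ - m₁ * ((+ 2) * a₁)
        b₂ = b₃ - m₂ * ((+ 2) * a₂)
        k = P * m₂ + R * m₁ + T * (c₃ - m₁ * m₂)
        D = b₃ * b₃ - (+ 4) * (a₁ * a₂) * c₃
    in (+ 2) * (P * (a₁ * b₂) + R * (a₂ * b₁) + T * G + k * ((+ 2) * (a₁ * a₂)))
       ≡ (+ 2) * b₃ * (P * a₁ + R * a₂) + T * ((+ 2) * G) - T * (b₁ * b₂ + D) + T * b₃ * (b₁ + b₂)
  expand = solve-∀
  collect : ∀ b₃ P a₁ R a₂ T W e →
    (+ 2) * b₃ * (P * a₁ + R * a₂) + T * W - T * W + T * b₃ * ((+ 2) * e) ≡ (+ 2) * b₃ * (P * a₁ + R * a₂ + T * e)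
  collect = solve-∀

module DirichletBasis
  (q₀ : Form) (disc<0 : disc q₀ < 0ℤ) (a₁ b₁ c₁ a₂ b₂ c₂ a₃ b₃ c₃ e : ℤ)
  (s₁ s₂ : Mat) (det-s₁ : det s₁ ≡ 1ℤ) (det-s₂ : det s₂ ≡ 1ℤ)
  (f₁≡ : form a₁ b₁ c₁ ≡ opposite q₀ · s₁) (f₂≡ : form a₂ b₂ c₂ ≡ opposite q₀ · s₂)
  (disc-f₃ : disc (form a₃ b₃ c₃) ≡ disc (form a₁ b₁ c₁)) (a₃≡ : a₃ ≡ a₁ * a₂)
  (b₁+b₂≡ : b₁ + b₂ ≡ (+ 2) * e) (coprime : gcd (gcd a₁ a₂) e ≡ 1ℤ)
  (2a₁∣b₃-b₁ : (+ 2) * a₁ Signed.∣ b₃ - b₁) (2a₂∣b₃-b₂ : (+ 2) * a₂ Signed.∣ b₃ - b₂)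
  where

  private
    q′ = opposite q₀
    u₁  = col₁ s₁
    u₁′ = col₂ s₁
    u₂  = col₁ s₂
    u₂′ = col₂ s₂

    coefficients = bézout₃ a₁ a₂ e
    P = proj₁ coefficients
    R = proj₁ (proj₂ coefficients)
    T = proj₁ (proj₂ (proj₂ coefficients))
    m₁ = Signed.quotient 2a₁∣b₃-b₁
    m₂ = Signed.quotient 2a₂∣b₃-b₂

    PRT≡1 : P * a₁ + R * a₂ + T * e ≡ 1ℤ
    PRT≡1 = trans (sym (proj₂ (proj₂ (proj₂ coefficients)))) coprime

    a₁≡ : a₁ ≡ value q′ u₁
    a₁≡ = cong Form.a f₁≡
    a₂≡ : a₂ ≡ value q′ u₂
    a₂≡ = cong Form.a f₂≡
    b₁≡ : b₁ ≡ polar q′ u₁ u₁′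
    b₁≡ = cong Form.b f₁≡
    b₂≡ : b₂ ≡ polar q′ u₂ u₂′
    b₂≡ = cong Form.b f₂≡

    times-det : ∀ {i j} s → i ≡ j → det s ≡ 1ℤ → j * det s ≡ i
    times-det {i} _ i≡j det≡1 = trans (cong₂ _*_ (sym i≡j) det≡1) (ℤₚ.*-identityʳ i)

    disc-f₁ : disc (form a₁ b₁ c₁) ≡ disc q₀
    disc-f₁ = trans (disc-∼ q′ (s₁ , det-s₁ , f₁≡)) (disc-opposite q₀)
    disc-f₂ : disc (form a₂ b₂ c₂) ≡ disc q₀
    disc-f₂ = trans (disc-∼ q′ (s₂ , det-s₂ , f₂≡)) (disc-opposite q₀)

    a₃≢0 : a₃ ≢ 0ℤ
    a₃≢0 a₃≡0 with ℤₚ.i*j≡0⇒i≡0∨j≡0 a₁ (trans (sym a₃≡) a₃≡0)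
    ... | inj₁ a₁≡0 = disc<0⇒a≢0 (form a₁ b₁ c₁) (subst (_< 0ℤ) (sym disc-f₁) disc<0) a₁≡0
    ... | inj₂ a₂≡0 = disc<0⇒a≢0 (form a₂ b₂ c₂) (subst (_< 0ℤ) (sym disc-f₂) disc<0) a₂≡0

    Y₁ = μ q₀ u₁ u₂′
    Y₂ = μ q₀ u₁′ u₂
    Y₃ = μ q₀ u₁′ u₂′
    k  = P * m₂ + R * m₁ + T * (c₃ - m₁ * m₂)

  -- assocForm e₁ Yᵢ is a₁ q₀, a₂ q₀, e q₀ for i = 1, 2, 3, so the Bézout combination gives
  -- assocForm e₁ e₂ = q₀; the multiple k of e₁, which does not change it, makes ⟨ e₁ , e₂ ⟩ = b₃.
  e₁ e₂ : L'
  e₁ = μ q₀ u₁ u₂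
  e₂ = P ⊛ Y₁ ⊕ R ⊛ Y₂ ⊕ T ⊛ Y₃ ⊕ k ⊛ e₁

  private
    e₁∧Y₁ : assocForm e₁ Y₁ ≡ scale a₁ q₀
    e₁∧Y₁ = trans (assocForm-μʳ q₀ u₁ u₂ u₂′) (cong (λ l → scale l q₀) (times-det s₂ a₁≡ det-s₂))

    e₁∧Y₂ : assocForm e₁ Y₂ ≡ scale a₂ q₀
    e₁∧Y₂ = trans (assocForm-μˡ q₀ u₁ u₂ u₁′) (cong (λ l → scale l q₀) (times-det s₁ a₂≡ det-s₁))

    e₁∧Y₃ : assocForm e₁ Y₃ ≡ scale e q₀
    e₁∧Y₃ = scale-injectiveʳ (+ 2) _ _ (λ ()) (begin
      scale (+ 2) (assocForm e₁ Y₃)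
        ≡⟨ assocForm-μ q₀ u₁ u₂ u₁′ u₂′ ⟩
      scale (polar q′ u₁ u₁′ * det₂ u₂ u₂′ + polar q′ u₂ u₂′ * det₂ u₁ u₁′) q₀
        ≡⟨ cong (λ l → scale l q₀) (cong₂ _+_ (times-det s₂ b₁≡ det-s₂) (times-det s₁ b₂≡ det-s₁)) ⟩
      scale (b₁ + b₂) q₀
        ≡⟨ cong (λ l → scale l q₀) b₁+b₂≡ ⟩
      scale ((+ 2) * e) q₀
        ≡⟨ scale-scale (+ 2) e q₀ ⟨
      scale (+ 2) (scale e q₀) ∎)
      where open ≡-Reasoning

  basis : assocForm e₁ e₂ ≡ q₀
  basis = begin
    assocForm e₁ e₂
      ≡⟨ assocForm-combʳ e₁ Y₁ Y₂ Y₃ P R T k ⟩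
    scale P (assocForm e₁ Y₁) ⊞ scale R (assocForm e₁ Y₂) ⊞ scale T (assocForm e₁ Y₃)
      ≡⟨ cong₃ (λ A B C → scale P A ⊞ scale R B ⊞ scale T C) e₁∧Y₁ e₁∧Y₂ e₁∧Y₃ ⟩
    scale P (scale a₁ q₀) ⊞ scale R (scale a₂ q₀) ⊞ scale T (scale e q₀)
      ≡⟨ scale-⊞ P R T a₁ a₂ e q₀ ⟩
    scale (P * a₁ + R * a₂ + T * e) q₀
      ≡⟨ cong (λ l → scale l q₀) PRT≡1 ⟩
    scale 1ℤ q₀
      ≡⟨ scale-1 q₀ ⟩
    q₀ ∎
    where open ≡-Reasoning

  private
    Q-e₁ : Q e₁ ≡ a₁ * a₂
    Q-e₁ = trans (Q-μ q₀ u₁ u₂) (sym (cong₂ _*_ a₁≡ a₂≡))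

    ⟨e₁,Y₁⟩ : ⟨ e₁ , Y₁ ⟩ ≡ a₁ * b₂
    ⟨e₁,Y₁⟩ = trans (⟨μ,μ⟩ʳ q₀ u₁ u₂ u₂′) (sym (cong₂ _*_ a₁≡ b₂≡))

    ⟨e₁,Y₂⟩ : ⟨ e₁ , Y₂ ⟩ ≡ a₂ * b₁
    ⟨e₁,Y₂⟩ = trans (⟨μ,μ⟩ˡ q₀ u₁ u₂ u₁′) (sym (cong₂ _*_ a₂≡ b₁≡))

    2⟨e₁,Y₃⟩ : (+ 2) * ⟨ e₁ , Y₃ ⟩ ≡ b₁ * b₂ + (b₃ * b₃ - (+ 4) * (a₁ * a₂) * c₃)
    2⟨e₁,Y₃⟩ = begin
      (+ 2) * ⟨ e₁ , Y₃ ⟩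
        ≡⟨ ⟨μ,μ⟩ q₀ u₁ u₂ u₁′ u₂′ ⟩
      polar q′ u₁ u₁′ * polar q′ u₂ u₂′ + disc q₀ * det₂ u₁ u₁′ * det₂ u₂ u₂′
        ≡⟨ cong₃ (λ B₁ B₂ D → B₁ * B₂ + D) (sym b₁≡) (sym b₂≡)
                 (trans (cong₂ (λ d₁ d₂ → disc q₀ * d₁ * d₂) det-s₁ det-s₂)
                        (trans (ℤₚ.*-identityʳ _) (ℤₚ.*-identityʳ _))) ⟩
      b₁ * b₂ + disc q₀
        ≡⟨ cong (λ D → b₁ * b₂ + D) (trans (sym disc-f₁) (sym disc-f₃)) ⟩
      b₁ * b₂ + (b₃ * b₃ - (+ 4) * a₃ * c₃)
        ≡⟨ cong (λ a → b₁ * b₂ + (b₃ * b₃ - (+ 4) * a * c₃)) a₃≡ ⟩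
      b₁ * b₂ + (b₃ * b₃ - (+ 4) * (a₁ * a₂) * c₃) ∎
      where open ≡-Reasoning

    ⟨e₁,e₂⟩ : ⟨ e₁ , e₂ ⟩ ≡ b₃
    ⟨e₁,e₂⟩ = begin
      ⟨ e₁ , e₂ ⟩
        ≡⟨ ⟨⟩-combʳ e₁ Y₁ Y₂ Y₃ P R T k ⟩
      P * ⟨ e₁ , Y₁ ⟩ + R * ⟨ e₁ , Y₂ ⟩ + T * ⟨ e₁ , Y₃ ⟩ + k * ((+ 2) * Q e₁)
        ≡⟨ cong₃ (λ x y z → P * x + R * y + T * ⟨ e₁ , Y₃ ⟩ + k * ((+ 2) * z)) ⟨e₁,Y₁⟩ ⟨e₁,Y₂⟩ Q-e₁ ⟩
      P * (a₁ * b₂) + R * (a₂ * b₁) + T * ⟨ e₁ , Y₃ ⟩ + k * ((+ 2) * (a₁ * a₂))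
        ≡⟨ dirichlet-middle-coefficient a₁ a₂ b₁ b₂ b₃ c₃ m₁ m₂ e P R T ⟨ e₁ , Y₃ ⟩
             (j≡i-k b₃ (Signed._∣_.equality 2a₁∣b₃-b₁)) (j≡i-k b₃ (Signed._∣_.equality 2a₂∣b₃-b₂))
             PRT≡1 b₁+b₂≡ 2⟨e₁,Y₃⟩ ⟩
      b₃ ∎
      where open ≡-Reasoning

    gram≡ : gram e₁ e₂ ≡ form a₃ b₃ (Q e₂)
    gram≡ = cong₃ form (trans Q-e₁ (sym a₃≡)) ⟨e₁,e₂⟩ refl

  -- Q e₂ is never computed: the discriminant of gram e₁ e₂ = disc q₀ = disc f₃ pins it down.
  gram-basis : gram e₁ e₂ ≡ form a₃ b₃ c₃
  gram-basis = trans gram≡ (cong (form a₃ b₃) (disc-determines-c a₃ b₃ (Q e₂) c₃ a₃≢0 (begin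
    disc (form a₃ b₃ (Q e₂))  ≡⟨ cong disc gram≡ ⟨
    disc (gram e₁ e₂)         ≡⟨ disc-gram e₁ e₂ ⟩
    disc (assocForm e₁ e₂)    ≡⟨ cong disc basis ⟩
    disc q₀                   ≡⟨ disc-f₁ ⟨
    disc (form a₁ b₁ c₁)      ≡⟨ disc-f₃ ⟨
    disc (form a₃ b₃ c₃)      ∎)))
    where open ≡-Reasoning

composition-basis : ∀ q₀ f₁ f₂ f₃ → disc q₀ < 0ℤ →
                    opposite q₀ ∼ f₁ → opposite q₀ ∼ f₂ → DirichletComp f₁ f₂ f₃ →
                    ∃₂ λ e₁ e₂ → assocForm e₁ e₂ ≡ q₀ × gram e₁ e₂ ≡ f₃
composition-basis q₀ (form a₁ b₁ c₁) (form a₂ b₂ c₂) (form a₃ b₃ c₃) disc<0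
                  (s₁ , det-s₁ , f₁≡) (s₂ , det-s₂ , f₂≡)
                  (_ , disc-f₃ , a₃≡ , (e , b₁+b₂≡ , coprime) , 2a₁∣b₃-b₁ , 2a₂∣b₃-b₂) =
  D.e₁ , D.e₂ , D.basis , D.gram-basis
  where
  module D = DirichletBasis q₀ disc<0 a₁ b₁ c₁ a₂ b₂ c₂ a₃ b₃ c₃ e s₁ s₂ det-s₁ det-s₂ f₁≡ f₂≡
                            disc-f₃ a₃≡ b₁+b₂≡ coprime (Signed.∣ᵤ⇒∣ 2a₁∣b₃-b₁) (Signed.∣ᵤ⇒∣ 2a₂∣b₃-b₂)

proposition4p4 : (d : ℤ) → d < 0ℤ → (t q : Form) →
    PosDef t → PosDef q → disc t ≡ d → disc q ≡ d →
    (q₀ : Form) → q ≡ scale (content q) q₀ →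
    (p : Form) → InClassMinusTwice q₀ p →
    ∃ λ (n : ℕ) → HasCard (MSet t q) n × HasCard (RSet p t) n
proposition4p4 _ _ t q _ (0<a , disc-q<0) disc-t disc-q q₀ q≡gq₀ p
               (f₁ , f₂ , f₃ , q₀⁻¹∼f₁ , q₀⁻¹∼f₂ , f₁∘f₂≡f₃ , f₃∼p) =
  let e₁ , e₂ , basis , gram≡f₃ = composition-basis q₀ f₁ f₂ f₃ disc-q₀<0 q₀⁻¹∼f₁ q₀⁻¹∼f₂ f₁∘f₂≡f₃
      disc-gram≡ = trans (disc-gram e₁ e₂) (cong disc basis)
      n , Fin↔R = finite-RSet (gram e₁ e₂) t (subst (_< 0ℤ) (sym disc-gram≡) disc-q₀<0)
      M↔R = MSet↔RSet e₁ e₂ q₀ g t basis (primitive-part q q₀ 0<g q≡gq₀) (ℤₚ.<⇒≢ disc-q₀<0) 0<g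
                      (trans disc-t (trans (sym disc-q) (cong disc q≡gq₀)))
  in n , ↔-trans Fin↔R (↔-sym (subst (λ q → MSet t q ↔ RSet (gram e₁ e₂) t) (sym q≡gq₀) M↔R))
       , ↔-trans Fin↔R (RSet-∼ (gram e₁ e₂) t (subst (_∼ p) (sym gram≡f₃) f₃∼p))
  where
  g = content q
  0<g = content-pos q 0<a
  disc-q₀<0 : disc q₀ < 0ℤ
  disc-q₀<0 = disc-scale-neg g q₀ (subst (λ f → disc f < 0ℤ) q≡gq₀ disc-q<0)
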